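{- Let $c$ and $c'$ be circular words with the same first letter $\alpha$. If $c \preceq c'$, then $c \preceq c : c' \preceq c' : c \preceq c'$.
   Context: Fix a finite nonempty set $D$ of positive integers and let $m=\max(D)+1$. A letter is an $m$-tuple $(b_1,\dots,b_m)\in\{0,1\}^m$; it is legal if $\{i : b_i=1\}$ contains no two elements differing by an element of $D$. A letter $(b'_1,\dots,b'_m)$ is a successor of $(b_1,\dots,b_m)$ iff $b'_i=b_{i+1}$ for $1\le i\le m-1$. A letter is a consonant if $b_1=1$ and a vowel if $b_1=0$. A circular word of length $a\ge1$ is a finite sequence $c=(x_0,x_1,\dots,x_a)$ of legal letters with each $x_{i+1}$ a successor of $x_i$ and $x_0=x_a$ (the first letter). Its generating function is $P_c(q)=\sum_{i=0}^{a-1}\varepsilon(x_i)q^i$, where $\varepsilon(x)=1$ if $x$ is a consonant and $0$ otherwise, and $|c|:=P_c(q)/(1-q^a)$. If $c=(x_0,\dots,x_a)$ and $c'=(x'_0,\dots,x'_{a'})$ are circular words with $x_a = x'_0$, their concatenation is the circular word $c:c'=(x_0,\dots,x_a,x'_1,\dots,x'_{a'})$ of length $a+a'$. For circular words, $c\preceq c'$ means there exists $\epsilon>0$ such that $|c|(q)\le|c'|(q)$ for all $q\in(1-\epsilon,1)$.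
   Formalization: In the relation $c\preceq c'$, both $\epsilon$ and the points $q$ of the interval $(1-\epsilon,1)$ are taken in the rationals. -}

module Defs where

open import Data.Nat as ℕ using (ℕ; zero; suc; _≤?_; _∸_)
open import Data.Bool using (Bool; true; false; if_then_else_)
open import Data.List using (List; []; foldr)
open import Data.List.Membership.Propositional using (_∈_)
open import Data.Fin using (Fin; toℕ; inject₁) renaming (zero to fzero; suc to fsuc)
open import Data.Vec using (Vec; lookup)
open import Data.Product using (Σ; _×_; ∃)
open import Data.Empty using (⊥)
open import Relation.Nullary using (¬_; yes; no)
open import Relation.Binary.PropositionalEquality using (_≡_)
open import Data.Rational as ℚ using (ℚ; 0ℚ; 1ℚ; _+_; _*_; _-_; _÷_; _≤_; _<_; NonZero)

maxL : List ℕ → ℕ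
maxL = foldr ℕ._⊔_ 0

record ValidD (D : List ℕ) : Set where
  field
    nonempty : ¬ (D ≡ [])
    positive : ∀ {d} → d ∈ D → 0 ℕ.< d

module _ (D : List ℕ) where

  -- m = max(D) + 1; a letter is an m-tuple of bits (index 0 ↔ b₁).
  m : ℕ
  m = suc (maxL D)

  Letter : Set
  Letter = Vec Bool m

  Legal : Letter → Set
  Legal x = ∀ (i j : Fin m) (d : ℕ) → d ∈ D →
            lookup x i ≡ true → lookup x j ≡ true →
            toℕ i ℕ.+ d ≡ toℕ j → ⊥

  Successor : Letter → Letter → Set
  Successor x x' = ∀ (i : Fin (maxL D)) → lookup x' (inject₁ i) ≡ lookup x (fsuc i)

  εL : Letter → ℚ
  εL x = if lookup x fzero then 1ℚ else 0ℚ

  -- A (raw) word: a length a and letters x₀, x₁, … (only x₀..x_a matter).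
  record Word : Set where
    constructor word
    field
      len     : ℕ
      letters : ℕ → Letter
  open Word public

  record IsCircular (c : Word) : Set where
    field
      len-pos : 1 ℕ.≤ len c
      legal   : ∀ i → i ℕ.≤ len c → Legal (letters c i)
      succ    : ∀ i → i ℕ.< len c → Successor (letters c i) (letters c (suc i))
      closed  : letters c (len c) ≡ letters c 0

  _∶_ : Word → Word → Word
  c ∶ c' = word (len c ℕ.+ len c')
               (λ i → if i ℕ.≤ᵇ len c then letters c i else letters c' (i ∸ len c))

  pow : ℚ → ℕ → ℚ
  pow q zero    = 1ℚ
  pow q (suc n) = q * pow q n

  P : Word → ℚ → ℚ
  P c q = go (len c)
    where
    go : ℕ → ℚ
    go zero    = 0ℚ
    go (suc i) = go i + εL (letters c i) * pow q i

  ∣_∣ : (c : Word) (q : ℚ) → .{{NonZero (1ℚ - pow q (len c))}} → ℚ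
  ∣ c ∣ q = P c q ÷ (1ℚ - pow q (len c))

  _⪯_ : Word → Word → Set
  c ⪯ c' = Σ ℚ λ ε → (0ℚ < ε) ×
             (∀ (q : ℚ) → (1ℚ - ε) < q → q < 1ℚ →
              (nz : NonZero (1ℚ - pow q (len c))) →
              (nz' : NonZero (1ℚ - pow q (len c'))) →
              ∣ c ∣ q {{nz}} ≤ ∣ c' ∣ q {{nz'}})

-- With u = q ^ |c| and v = q ^ |c'|, the word c : c' has generating function P_c + u P_c' and
-- denominator 1 - u v = (1 - u) + u (1 - v), so |c : c'| is a mediant of |c| = P_c / (1 - u) and
-- |c'| = P_c' / (1 - v) with weight u ≥ 0, and lies between them; likewise |c' : c| with weight v.
-- The two concatenations share the denominator 1 - u v, and their numerators differ by
-- P_c' (1 - u) - P_c (1 - v) ≥ 0.  For 0 ≤ q < 1 every denominator is positive, so all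
-- comparisons are made after cross-multiplying.
module Submission where

open import Defs
open import Data.Bool using (true; false)
open import Data.List using (List)
open import Data.Nat as ℕ using (ℕ; zero; suc; _∸_; z<s)
import Data.Nat.Properties as ℕ
open import Data.Product using (Σ-syntax; _×_; _,_)
open import Data.Rational hiding (∣_∣)
open import Data.Rational.Properties
open import Data.Sum using (inj₁; inj₂)
open import Function using (_∘_)
open import Level using (0ℓ)
open import Relation.Binary.PropositionalEquality
open import Relation.Nullary using (contradiction; ofʸ; ofⁿ)
open import Relation.Nullary.Decidable using (dec⇒maybe)
open import Tactic.RingSolver using (solve-∀)
open import Tactic.RingSolver.Core.AlmostCommutativeRing using (AlmostCommutativeRing; fromCommutativeRing)

-- The zero test makes normal forms canonical; without it identities whose constants cancel are not solved.
ℚ-ring : AlmostCommutativeRing 0ℓ 0ℓ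
ℚ-ring = fromCommutativeRing +-*-commutativeRing (λ p → dec⇒maybe (0ℚ ≟ p))

p≤q⇒0≤q-p : ∀ {p q} → p ≤ q → 0ℚ ≤ q - p
p≤q⇒0≤q-p {p} {q} p≤q = subst (_≤ q - p) (+-inverseʳ p) (+-monoˡ-≤ (- p) p≤q)

p<q⇒0<q-p : ∀ {p q} → p < q → 0ℚ < q - p
p<q⇒0<q-p {p} {q} p<q = subst (_< q - p) (+-inverseʳ p) (+-monoˡ-< (- p) p<q)

0<p⊓q : ∀ {p q} → 0ℚ < p → 0ℚ < q → 0ℚ < p ⊓ q
0<p⊓q {p} {q} 0<p 0<q with ⊓-sel p q
... | inj₁ p⊓q≡p rewrite p⊓q≡p = 0<p
... | inj₂ p⊓q≡q rewrite p⊓q≡q = 0<q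

-- By definition, c ⪯ d is NearOne (c ⪯[_] d) with _⪯[_]_ as below.
NearOne : (ℚ → Set) → Set
NearOne R = Σ[ ε ∈ ℚ ] 0ℚ < ε × (∀ q → 1ℚ - ε < q → q < 1ℚ → R q)

nearOne-mono : ∀ {R S : ℚ → Set} → (∀ {q} → 0ℚ ≤ q → q < 1ℚ → R q → S q) → NearOne R → NearOne S
nearOne-mono {R} {S} R⇒S (ε , 0<ε , R-near) = ε ⊓ 1ℚ , 0<p⊓q 0<ε (positive⁻¹ 1ℚ) , S-near
  where
  S-near : ∀ q → 1ℚ - ε ⊓ 1ℚ < q → q < 1ℚ → S q
  S-near q 1-ε⊓1<q q<1 = R⇒S (<⇒≤ (≤-<-trans (p≤q⇒0≤q-p (p⊓q≤q ε 1ℚ)) 1-ε⊓1<q)) q<1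
    (R-near q (≤-<-trans (+-monoʳ-≤ 1ℚ (neg-antimono-≤ (p⊓q≤p ε 1ℚ))) 1-ε⊓1<q) q<1)

p÷q*[q*r]≡p*r : ∀ p q r .{{_ : NonZero q}} → (p ÷ q) * (q * r) ≡ p * r
p÷q*[q*r]≡p*r p q r = begin
  p * 1/ q * (q * r)  ≡⟨ rearrange p (1/ q) q r ⟩
  p * r * (1/ q * q)  ≡⟨ cong (p * r *_) (*-inverseˡ q) ⟩
  p * r * 1ℚ          ≡⟨ *-identityʳ (p * r) ⟩
  p * r               ∎
  where
  open ≡-Reasoning
  rearrange : ∀ p i q r → p * i * (q * r) ≡ p * r * (i * q)
  rearrange = solve-∀ ℚ-ring

module _ {x y A B : ℚ} .{{_ : NonZero A}} .{{_ : NonZero B}} (0<A : 0ℚ < A) (0<B : 0ℚ < B) where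
  private
    instance
      A*B-pos : Positive (A * B)
      A*B-pos = pos*pos⇒pos A {{positive 0<A}} B {{positive 0<B}}

    x÷A*[A*B]≡x*B : (x ÷ A) * (A * B) ≡ x * B
    x÷A*[A*B]≡x*B = p÷q*[q*r]≡p*r x A B

    y÷B*[A*B]≡y*A : (y ÷ B) * (A * B) ≡ y * A
    y÷B*[A*B]≡y*A = trans (cong ((y ÷ B) *_) (*-comm A B)) (p÷q*[q*r]≡p*r y B A)

  ÷≤÷⇒*≤* : x ÷ A ≤ y ÷ B → x * B ≤ y * A
  ÷≤÷⇒*≤* x÷A≤y÷B =
    subst₂ _≤_ x÷A*[A*B]≡x*B y÷B*[A*B]≡y*A (*-monoʳ-≤-nonNeg (A * B) {{pos⇒nonNeg (A * B)}} x÷A≤y÷B)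

  *≤*⇒÷≤÷ : x * B ≤ y * A → x ÷ A ≤ y ÷ B
  *≤*⇒÷≤÷ xB≤yA = *-cancelʳ-≤-pos (A * B) (subst₂ _≤_ (sym x÷A*[A*B]≡x*B) (sym y÷B*[A*B]≡y*A) xB≤yA)

-- Cross-multiplied: if x/A ≤ y/B then x/A ≤ (x + k y)/(A + k B) and (y + k x)/(B + k A) ≤ y/B.
module _ (x y A B : ℚ) {k : ℚ} (0≤k : 0ℚ ≤ k) (xB≤yA : x * B ≤ y * A) where
  private
    k*xB≤k*yA : k * (x * B) ≤ k * (y * A)
    k*xB≤k*yA = *-monoˡ-≤-nonNeg k {{nonNegative 0≤k}} xB≤yA

  ≤-mediant : x * (A + k * B) ≤ (x + k * y) * A
  ≤-mediant = begin
    x * (A + k * B)      ≡⟨ expand x A k B ⟩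
    x * A + k * (x * B)  ≤⟨ +-monoʳ-≤ (x * A) k*xB≤k*yA ⟩
    x * A + k * (y * A)  ≡⟨ collect x A k y ⟩
    (x + k * y) * A      ∎
    where
    open ≤-Reasoning
    expand : ∀ x A k B → x * (A + k * B) ≡ x * A + k * (x * B)
    expand = solve-∀ ℚ-ring
    collect : ∀ x A k y → x * A + k * (y * A) ≡ (x + k * y) * A
    collect = solve-∀ ℚ-ring

  mediant-≤ : (y + k * x) * B ≤ y * (B + k * A)
  mediant-≤ = begin
    (y + k * x) * B      ≡⟨ expand y B k x ⟩
    y * B + k * (x * B)  ≤⟨ +-monoʳ-≤ (y * B) k*xB≤k*yA ⟩
    y * B + k * (y * A)  ≡⟨ collect y B k A ⟩
    y * (B + k * A)      ∎
    where
    open ≤-Reasoning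
    expand : ∀ y B k x → (y + k * x) * B ≡ y * B + k * (x * B)
    expand = solve-∀ ℚ-ring
    collect : ∀ y B k A → y * B + k * (y * A) ≡ y * (B + k * A)
    collect = solve-∀ ℚ-ring

module _ {D : List ℕ} where
  private
    infixr 8 _^_
    _^_ : ℚ → ℕ → ℚ
    q ^ n = pow D q n

  ^-distribˡ-+-* : ∀ q m n → q ^ (m ℕ.+ n) ≡ q ^ m * q ^ n
  ^-distribˡ-+-* q zero    n = sym (*-identityˡ (q ^ n))
  ^-distribˡ-+-* q (suc m) n = trans (cong (q *_) (^-distribˡ-+-* q m n)) (sym (*-assoc q (q ^ m) (q ^ n)))

  1-q^[m+n] : ∀ q m n → 1ℚ - q ^ (m ℕ.+ n) ≡ (1ℚ - q ^ m) + q ^ m * (1ℚ - q ^ n)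
  1-q^[m+n] q m n = trans (cong (λ u → 1ℚ - u) (^-distribˡ-+-* q m n)) (split (q ^ m) (q ^ n))
    where
    split : ∀ u v → 1ℚ - u * v ≡ (1ℚ - u) + u * (1ℚ - v)
    split = solve-∀ ℚ-ring

  module _ {q : ℚ} (0≤q : 0ℚ ≤ q) where
    private
      instance
        q-nonNeg : NonNegative q
        q-nonNeg = nonNegative 0≤q

    ^-nonNeg : ∀ n → 0ℚ ≤ q ^ n
    ^-nonNeg zero    = nonNegative⁻¹ 1ℚ
    ^-nonNeg (suc n) = nonNegative⁻¹ (q * q ^ n) {{nonNeg*nonNeg⇒nonNeg q (q ^ n) {{nonNegative (^-nonNeg n)}}}}

    ^-≤1 : q ≤ 1ℚ → ∀ n → q ^ n ≤ 1ℚ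
    ^-≤1 q≤1 zero    = ≤-refl
    ^-≤1 q≤1 (suc n) = begin
      q * q ^ n  ≤⟨ *-monoˡ-≤-nonNeg q (^-≤1 q≤1 n) ⟩
      q * 1ℚ     ≡⟨ *-identityʳ q ⟩
      q          ≤⟨ q≤1 ⟩
      1ℚ         ∎
      where open ≤-Reasoning

    ^-<1 : q < 1ℚ → ∀ n → 1 ℕ.≤ n → q ^ n < 1ℚ
    ^-<1 q<1 (suc n) _ = begin-strict
      q * q ^ n  ≤⟨ *-monoˡ-≤-nonNeg q (^-≤1 (<⇒≤ q<1) n) ⟩
      q * 1ℚ     ≡⟨ *-identityʳ q ⟩
      q          <⟨ q<1 ⟩
      1ℚ         ∎
      where open ≤-Reasoning

  series : (ℕ → ℚ) → ℚ → ℕ → ℚ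
  series f q zero    = 0ℚ
  series f q (suc n) = series f q n + f n * q ^ n

  series-unique : ∀ f q {g : ℕ → ℚ} → g 0 ≡ 0ℚ → (∀ n → g (suc n) ≡ g n + f n * q ^ n) →
                  ∀ n → g n ≡ series f q n
  series-unique f q     g0≡0 g-suc zero    = g0≡0
  series-unique f q {g} g0≡0 g-suc (suc n) =
    trans (g-suc n) (cong (_+ f n * q ^ n) (series-unique f q {g} g0≡0 g-suc n))

  series-cong : ∀ {f g} q n → (∀ i → i ℕ.< n → f i ≡ g i) → series f q n ≡ series g q n
  series-cong q zero    f≗g = refl
  series-cong q (suc n) f≗g =
    cong₂ (λ s a → s + a * q ^ n) (series-cong q n (λ i i<n → f≗g i (ℕ.m<n⇒m<1+n i<n))) (f≗g n ℕ.≤-refl)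

  series-+ : ∀ f q m n → series f q (m ℕ.+ n) ≡ series f q m + q ^ m * series (f ∘ (m ℕ.+_)) q n
  series-+ f q m zero = trans (cong (series f q) (ℕ.+-identityʳ m)) (sym (add-zero (series f q m) (q ^ m)))
    where
    add-zero : ∀ s u → s + u * 0ℚ ≡ s
    add-zero = solve-∀ ℚ-ring
  series-+ f q m (suc n) = begin
    series f q (m ℕ.+ suc n)                                          ≡⟨ cong (series f q) (ℕ.+-suc m n) ⟩
    series f q (m ℕ.+ n) + f (m ℕ.+ n) * q ^ (m ℕ.+ n)                ≡⟨ cong₂ (λ s u → s + f (m ℕ.+ n) * u) (series-+ f q m n) (^-distribˡ-+-* q m n) ⟩
    (series f q m + q ^ m * t) + f (m ℕ.+ n) * (q ^ m * q ^ n)        ≡⟨ regroup (series f q m) (q ^ m) t (f (m ℕ.+ n)) (q ^ n) ⟩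
    series f q m + q ^ m * (t + f (m ℕ.+ n) * q ^ n)                  ∎
    where
    open ≡-Reasoning
    t : ℚ
    t = series (f ∘ (m ℕ.+_)) q n
    regroup : ∀ s u t a v → (s + u * t) + a * (u * v) ≡ s + u * (t + a * v)
    regroup = solve-∀ ℚ-ring

  -- P c q unfolds to an auxiliary recursion on len c that cannot be named here;
  -- abstracting len c lets unification recover it as the g of series-unique.
  P≡series : ∀ c q → P D c q ≡ series (εL D ∘ letters c) q (len c)
  P≡series c q with series-unique (εL D ∘ letters c) q refl (λ _ → refl) | len c
  ... | go≡series | a = go≡series a

  module _ (c c' : Word D) where
    letters-∶-≤ : ∀ {i} → i ℕ.≤ len c → letters (_∶_ D c c') i ≡ letters c i
    letters-∶-≤ {i} i≤a with i ℕ.≤ᵇ len c | ℕ.≤ᵇ-reflects-≤ i (len c)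
    ... | true  | _       = refl
    ... | false | ofⁿ i≰a = contradiction i≤a i≰a

    letters-∶-> : ∀ {i} → len c ℕ.< i → letters (_∶_ D c c') i ≡ letters c' (i ∸ len c)
    letters-∶-> {i} a<i with i ℕ.≤ᵇ len c | ℕ.≤ᵇ-reflects-≤ i (len c)
    ... | true  | ofʸ i≤a = contradiction i≤a (ℕ.<⇒≱ a<i)
    ... | false | _       = refl

    letters-∶-+ : letters c (len c) ≡ letters c' 0 → ∀ j → letters (_∶_ D c c') (len c ℕ.+ j) ≡ letters c' j
    letters-∶-+ c→c' zero = begin
      letters (_∶_ D c c') (len c ℕ.+ 0)  ≡⟨ cong (letters (_∶_ D c c')) (ℕ.+-identityʳ (len c)) ⟩
      letters (_∶_ D c c') (len c)        ≡⟨ letters-∶-≤ ℕ.≤-refl ⟩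
      letters c (len c)                   ≡⟨ c→c' ⟩
      letters c' 0                        ∎
      where open ≡-Reasoning
    letters-∶-+ c→c' (suc j) =
      trans (letters-∶-> (ℕ.m<m+n (len c) z<s)) (cong (letters c') (ℕ.m+n∸m≡n (len c) (suc j)))

    P-∶ : ∀ q → letters c (len c) ≡ letters c' 0 → P D (_∶_ D c c') q ≡ P D c q + q ^ len c * P D c' q
    P-∶ q c→c' = begin
      P D (_∶_ D c c') q
        ≡⟨ P≡series (_∶_ D c c') q ⟩
      series (ε ∘ letters (_∶_ D c c')) q (len c ℕ.+ len c')
        ≡⟨ series-+ (ε ∘ letters (_∶_ D c c')) q (len c) (len c') ⟩
      series (ε ∘ letters (_∶_ D c c')) q (len c) + q ^ len c * series (ε ∘ letters (_∶_ D c c') ∘ (len c ℕ.+_)) q (len c')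
        ≡⟨ cong₂ (λ s t → s + q ^ len c * t)
                 (series-cong q (len c) (λ i i<a → cong ε (letters-∶-≤ (ℕ.<⇒≤ i<a))))
                 (series-cong q (len c') (λ j _ → cong ε (letters-∶-+ c→c' j))) ⟩
      series (ε ∘ letters c) q (len c) + q ^ len c * series (ε ∘ letters c') q (len c')
        ≡⟨ cong₂ (λ s t → s + q ^ len c * t) (P≡series c q) (P≡series c' q) ⟨
      P D c q + q ^ len c * P D c' q
        ∎
      where
      open ≡-Reasoning
      ε : Letter D → ℚ
      ε = εL D

  _⪯[_]_ : Word D → ℚ → Word D → Set
  c ⪯[ q ] d = (nz : NonZero (1ℚ - q ^ len c)) (nz' : NonZero (1ℚ - q ^ len d)) → ∣_∣ D c q {{nz}} ≤ ∣_∣ D d q {{nz'}}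

  module _ (c d : Word D) (q : ℚ) (0<A : 0ℚ < 1ℚ - q ^ len c) (0<B : 0ℚ < 1ℚ - q ^ len d) where
    ⪯[]⇒cross : c ⪯[ q ] d → P D c q * (1ℚ - q ^ len d) ≤ P D d q * (1ℚ - q ^ len c)
    ⪯[]⇒cross c⪯d = ÷≤÷⇒*≤* {P D c q} {P D d q} {{nzA}} {{nzB}} 0<A 0<B (c⪯d nzA nzB)
      where
      nzA : NonZero (1ℚ - q ^ len c)
      nzA = pos⇒nonZero (1ℚ - q ^ len c) {{positive 0<A}}
      nzB : NonZero (1ℚ - q ^ len d)
      nzB = pos⇒nonZero (1ℚ - q ^ len d) {{positive 0<B}}

    cross⇒⪯[] : P D c q * (1ℚ - q ^ len d) ≤ P D d q * (1ℚ - q ^ len c) → c ⪯[ q ] d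
    cross⇒⪯[] xB≤yA nz nz' = *≤*⇒÷≤÷ {P D c q} {P D d q} {{nz}} {{nz'}} 0<A 0<B xB≤yA

  module _ (c c' : Word D) (1≤a : 1 ℕ.≤ len c) (1≤b : 1 ℕ.≤ len c') {q : ℚ} (0≤q : 0ℚ ≤ q) (q<1 : q < 1ℚ) where
    private
      a b : ℕ
      a = len c
      b = len c'
      X Y u v : ℚ
      X = P D c q
      Y = P D c' q
      u = q ^ a
      v = q ^ b

      0<1-q^ : ∀ {n} → 1 ℕ.≤ n → 0ℚ < 1ℚ - q ^ n
      0<1-q^ {n} 1≤n = p<q⇒0<q-p (^-<1 0≤q q<1 n 1≤n)

      0<1-u : 0ℚ < 1ℚ - u
      0<1-u = 0<1-q^ 1≤a
      0<1-v : 0ℚ < 1ℚ - v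
      0<1-v = 0<1-q^ 1≤b
      0<1-q^[a+b] : 0ℚ < 1ℚ - q ^ (a ℕ.+ b)
      0<1-q^[a+b] = 0<1-q^ (ℕ.≤-trans 1≤a (ℕ.m≤m+n a b))
      0<1-q^[b+a] : 0ℚ < 1ℚ - q ^ (b ℕ.+ a)
      0<1-q^[b+a] = 0<1-q^ (ℕ.≤-trans 1≤b (ℕ.m≤m+n b a))

      X*[1-v]≤Y*[1-u] : c ⪯[ q ] c' → X * (1ℚ - v) ≤ Y * (1ℚ - u)
      X*[1-v]≤Y*[1-u] = ⪯[]⇒cross c c' q 0<1-u 0<1-v

    c⪯[]c∶c' : letters c a ≡ letters c' 0 → c ⪯[ q ] c' → c ⪯[ q ] _∶_ D c c'
    c⪯[]c∶c' c→c' c⪯c' = cross⇒⪯[] c (_∶_ D c c') q 0<1-u 0<1-q^[a+b] (begin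
      X * (1ℚ - q ^ (a ℕ.+ b))          ≡⟨ cong (X *_) (1-q^[m+n] q a b) ⟩
      X * ((1ℚ - u) + u * (1ℚ - v))     ≤⟨ ≤-mediant X Y (1ℚ - u) (1ℚ - v) (^-nonNeg 0≤q a) (X*[1-v]≤Y*[1-u] c⪯c') ⟩
      (X + u * Y) * (1ℚ - u)            ≡⟨ cong (_* (1ℚ - u)) (P-∶ c c' q c→c') ⟨
      P D (_∶_ D c c') q * (1ℚ - u)     ∎)
      where open ≤-Reasoning

    c∶c'⪯[]c'∶c : letters c a ≡ letters c' 0 → letters c' b ≡ letters c 0 → c ⪯[ q ] c' → _∶_ D c c' ⪯[ q ] _∶_ D c' c
    c∶c'⪯[]c'∶c c→c' c'→c c⪯c' = cross⇒⪯[] (_∶_ D c c') (_∶_ D c' c) q 0<1-q^[a+b] 0<1-q^[b+a] (begin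
      P D (_∶_ D c c') q * (1ℚ - q ^ (b ℕ.+ a))  ≡⟨ cong₂ _*_ (P-∶ c c' q c→c') (cong (λ n → 1ℚ - q ^ n) (ℕ.+-comm b a)) ⟩
      (X + u * Y) * (1ℚ - q ^ (a ℕ.+ b))         ≤⟨ *-monoʳ-≤-nonNeg (1ℚ - q ^ (a ℕ.+ b)) {{nonNegative (<⇒≤ 0<1-q^[a+b])}} X+uY≤Y+vX ⟩
      (Y + v * X) * (1ℚ - q ^ (a ℕ.+ b))         ≡⟨ cong (_* (1ℚ - q ^ (a ℕ.+ b))) (P-∶ c' c q c'→c) ⟨
      P D (_∶_ D c' c) q * (1ℚ - q ^ (a ℕ.+ b))  ∎)
      where
      open ≤-Reasoning
      X+uY≤Y+vX : X + u * Y ≤ Y + v * X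
      X+uY≤Y+vX = begin
        X + u * Y                        ≡⟨ shift X Y u v ⟩
        X * (1ℚ - v) + (u * Y + v * X)   ≤⟨ +-monoˡ-≤ (u * Y + v * X) (X*[1-v]≤Y*[1-u] c⪯c') ⟩
        Y * (1ℚ - u) + (u * Y + v * X)   ≡⟨ unshift X Y u v ⟩
        Y + v * X                        ∎
        where
        shift : ∀ X Y u v → X + u * Y ≡ X * (1ℚ - v) + (u * Y + v * X)
        shift = solve-∀ ℚ-ring
        unshift : ∀ X Y u v → Y * (1ℚ - u) + (u * Y + v * X) ≡ Y + v * X
        unshift = solve-∀ ℚ-ring

    c'∶c⪯[]c' : letters c' b ≡ letters c 0 → c ⪯[ q ] c' → _∶_ D c' c ⪯[ q ] c'
    c'∶c⪯[]c' c'→c c⪯c' = cross⇒⪯[] (_∶_ D c' c) c' q 0<1-q^[b+a] 0<1-v (begin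
      P D (_∶_ D c' c) q * (1ℚ - v)     ≡⟨ cong (_* (1ℚ - v)) (P-∶ c' c q c'→c) ⟩
      (Y + v * X) * (1ℚ - v)            ≤⟨ mediant-≤ X Y (1ℚ - u) (1ℚ - v) (^-nonNeg 0≤q b) (X*[1-v]≤Y*[1-u] c⪯c') ⟩
      Y * ((1ℚ - v) + v * (1ℚ - u))     ≡⟨ cong (Y *_) (1-q^[m+n] q b a) ⟨
      Y * (1ℚ - q ^ (b ℕ.+ a))          ∎)
      where open ≤-Reasoning

lemma5 : (D : List ℕ) → ValidD D →
           (c c' : Word D) → IsCircular D c → IsCircular D c' →
           letters c 0 ≡ letters c' 0 →
           _⪯_ D c c' →
           (_⪯_ D c (_∶_ D c c') × _⪯_ D (_∶_ D c c') (_∶_ D c' c)) × _⪯_ D (_∶_ D c' c) c'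
lemma5 D _ c c' c-circ c'-circ x₀≡x₀' c⪯c' =
    ( nearOne-mono (λ 0≤q q<1 → c⪯[]c∶c' c c' 1≤a 1≤b 0≤q q<1 c→c') c⪯c'
    , nearOne-mono (λ 0≤q q<1 → c∶c'⪯[]c'∶c c c' 1≤a 1≤b 0≤q q<1 c→c' c'→c) c⪯c' )
  , nearOne-mono (λ 0≤q q<1 → c'∶c⪯[]c' c c' 1≤a 1≤b 0≤q q<1 c'→c) c⪯c'
  where
  open IsCircular
  1≤a : 1 ℕ.≤ len c
  1≤a = len-pos c-circ
  1≤b : 1 ℕ.≤ len c'
  1≤b = len-pos c'-circ
  c→c' : letters c (len c) ≡ letters c' 0
  c→c' = trans (closed c-circ) x₀≡x₀'
  c'→c : letters c' (len c') ≡ letters c 0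
  c'→c = trans (closed c'-circ) (sym x₀≡x₀')
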